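{- Let $P\subset\mathbb{Z}^d$ be a $d$--polycube and let a chess piece be given by a set $D=\{u_1,\dots,u_m\}$ of $m$ nonzero vectors of $\mathbb{Z}^d$, no two of which are equal or opposite (its $m$ attack directions). Let $G$ be the associated chess graph. Then $G$ is $(m+1)$--claw free, i.e. $G$ contains no induced subgraph isomorphic to the complete bipartite graph $K_{1,m+1}$. In particular, the rook graph of a $d$--polycube is $(d+1)$--claw free and the queen graph is $\left(\frac{3^d-1}{2}+1\right)$--claw free.
   Context: A $d$--polycube is a finite union of unit cubes of the cubic tessellation of $\mathbb{R}^d$ with connected interior; identify cubes with their centers, so $P\subset\mathbb{Z}^d$ is finite. A piece with attack directions $D$ placed on $p\in P$ guards $p+ku$ for each $u\in D\cup(-D)$ and each integer $k\ge1$ such that $p+ju\in P$ for all $1\le j\le k$. The rook corresponds to $D=\{e_1,\dots,e_d\}$ ($m=d$), the queen to a set of representatives of $\{ -1,0,1\}^d\setminus\{0\}$ modulo $u\sim -u$ ($m=(3^d-1)/2$). The chess graph of $P$ for the piece has one vertex per cube of $P$ and an edge between two cubes if the piece placed on one guards the other. For $m\ge1$, the $m$--claw is $K_{1,m}$; a graph is $m$--claw free if it has no induced subgraph isomorphic to $K_{1,m}$. -}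

module Defs where

open import Data.Nat using (ℕ; suc; _≤_)
open import Data.Integer using (ℤ; +_; _+_; _*_; -_)
open import Data.Fin using (Fin)
open import Data.Vec using (Vec; zipWith; map; replicate; updateAt)
open import Data.List using (List)
open import Data.List.Membership.Propositional using (_∈_)
open import Data.Product using (Σ; ∃; _×_)
open import Data.Sum using (_⊎_)
open import Relation.Binary.PropositionalEquality using (_≡_)
open import Relation.Nullary using (¬_)

-- Points of ℤ^d (centres of unit cubes).
Pt : ℕ → Set
Pt d = Vec ℤ d

_⊕_ : ∀ {d} → Pt d → Pt d → Pt d
_⊕_ = zipWith _+_

_·_ : ∀ {d} → ℕ → Pt d → Pt d
k · u = map (λ x → (+ k) * x) u

neg : ∀ {d} → Pt d → Pt d
neg = map -_

zeroPt : ∀ {d} → Pt d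
zeroPt = replicate _ (+ 0)

Cubes : ℕ → Set
Cubes d = List (Pt d)

-- Two cubes share a (d-1)-face: they differ by ±1 in exactly one coordinate.
FaceAdj : ∀ {d} → Pt d → Pt d → Set
FaceAdj {d} p q = Σ (Fin d) λ i →
  (q ≡ updateAt p i (λ x → x + + 1)) ⊎ (q ≡ updateAt p i (λ x → x + - (+ 1)))

data FacePath {d} (P : Cubes d) : Pt d → Pt d → Set where
  here : ∀ {p} → FacePath P p p
  step : ∀ {p q r} → FaceAdj p q → q ∈ P → FacePath P q r → FacePath P p r

-- A d-polycube: the union of the cubes of P has connected interior,
-- i.e. any two cubes of P are joined by a chain of face-adjacent cubes of P.
IsPolycube : ∀ {d} → Cubes d → Set
IsPolycube {d} P = ∀ {p q} → p ∈ P → q ∈ P → FacePath P p q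

ValidDirections : ∀ {d m} → Vec (Pt d) m → Set
ValidDirections {d} {m} D =
  (∀ i → ¬ (Data.Vec.lookup D i ≡ zeroPt)) ×
  (∀ i j → ¬ (i ≡ j) →
     ¬ (Data.Vec.lookup D i ≡ Data.Vec.lookup D j) ×
     ¬ (Data.Vec.lookup D i ≡ neg (Data.Vec.lookup D j)))

GuardsAlong : ∀ {d} → Cubes d → Pt d → Pt d → Pt d → Set
GuardsAlong P u p q = Σ ℕ λ k → (1 ≤ k) × (q ≡ p ⊕ (k · u)) ×
  (∀ j → 1 ≤ j → j ≤ k → (p ⊕ (j · u)) ∈ P)

Guards : ∀ {d m} → Cubes d → Vec (Pt d) m → Pt d → Pt d → Set
Guards P D p q = ∃ λ i →
  GuardsAlong P (Data.Vec.lookup D i) p q ⊎ GuardsAlong P (neg (Data.Vec.lookup D i)) p q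

ChessAdj : ∀ {d m} → Cubes d → Vec (Pt d) m → Pt d → Pt d → Set
ChessAdj P D p q = (p ∈ P) × (q ∈ P) × (Guards P D p q ⊎ Guards P D q p)

InducedClaw : ∀ {d} → Cubes d → (Pt d → Pt d → Set) → ℕ → Set
InducedClaw {d} P Adj n = Σ (Pt d) λ c → Σ (Fin n → Pt d) λ f →
  (c ∈ P) × (∀ i → f i ∈ P) ×
  (∀ i j → f i ≡ f j → i ≡ j) ×
  (∀ i → ¬ (c ≡ f i)) ×
  (∀ i → Adj c (f i)) ×
  (∀ i j → ¬ (i ≡ j) → ¬ Adj (f i) (f j))

ClawFree : ∀ {d} → Cubes d → (Pt d → Pt d → Set) → ℕ → Set
ClawFree P Adj n = ¬ InducedClaw P Adj n

-- Every neighbour q of a cube c in the chess graph lies on one of the m lines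
-- through c spanned by the attack directions, and the closed segment from c to q
-- lies in P.  Among m + 1 leaves of a claw centred at c, two lie on the same
-- line by pigeonhole; the segments from c to each of them cover the segment
-- joining them, so the piece on one of them guards the other and they are
-- adjacent.
module Submission where

open import Defs
open import Data.Nat as ℕ using (ℕ; zero; suc; z≤n; s≤s)
import Data.Nat.Properties as ℕ
open import Data.Integer as ℤ using (ℤ; +_; _+_; _*_; -_; _-_; 0ℤ; 1ℤ; +≤+)
open import Data.Integer.Properties
  using (≤-trans; ≤-antisym; ≤-total; <-cmp; +-monoʳ-≤; i≤i+j; +-identityʳ;
         +-inverseʳ; neg-mono-≤; neg-involutive; i<j⇒suc[i]≤j; i≤j⇒0≤j-i; 0≤i⇒+∣i∣≡i)
open import Data.Integer.Tactic.RingSolver using (solve-∀)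
open import Data.Fin as Fin using (Fin)
open import Data.Fin.Properties using (pigeonhole; <⇒≢)
open import Data.Vec using (Vec; []; _∷_; zipWith; lookup)
open import Data.List.Membership.Propositional using (_∈_)
open import Data.Product using (∃; _×_; _,_; proj₁)
open import Data.Sum using (_⊎_; inj₁; inj₂)
open import Relation.Binary.PropositionalEquality
open import Relation.Binary.Definitions using (tri<; tri≈; tri>)

line : ∀ {d} → Pt d → Pt d → ℤ → Pt d
line c u t = zipWith (λ a b → a + t * b) c u

⊕-·-line : ∀ {d} (c u : Pt d) k → c ⊕ (k · u) ≡ line c u (+ k)
⊕-·-line []      []      k = refl
⊕-·-line (a ∷ c) (b ∷ u) k = cong (a + + k * b ∷_) (⊕-·-line c u k)

line-0 : ∀ {d} (c u : Pt d) → line c u 0ℤ ≡ c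
line-0 []      []      = refl
line-0 (a ∷ c) (b ∷ u) = cong₂ _∷_ (scalar a b) (line-0 c u)
  where scalar : ∀ a b → a + 0ℤ * b ≡ a
        scalar = solve-∀

line-neg : ∀ {d} (c u : Pt d) t → line c (neg u) t ≡ line c u (- t)
line-neg []      []      t = refl
line-neg (a ∷ c) (b ∷ u) t = cong₂ _∷_ (scalar a b t) (line-neg c u t)
  where scalar : ∀ a b t → a + t * (- b) ≡ a + (- t) * b
        scalar = solve-∀

line-line : ∀ {d} (c u : Pt d) t s → line (line c u t) u s ≡ line c u (t + s)
line-line []      []      t s = refl
line-line (a ∷ c) (b ∷ u) t s = cong₂ _∷_ (scalar a b t s) (line-line c u t s)
  where scalar : ∀ a b t s → (a + t * b) + s * b ≡ a + (t + s) * b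
        scalar = solve-∀

Between : ℤ → ℤ → ℤ → Set
Between a b s = (a ℤ.≤ s × s ℤ.≤ b) ⊎ (b ℤ.≤ s × s ℤ.≤ a)

Between-sym : ∀ {a b s} → Between a b s → Between b a s
Between-sym (inj₁ bounds) = inj₂ bounds
Between-sym (inj₂ bounds) = inj₁ bounds

Between-+ˡ : ∀ c {a b s} → Between a b s → Between (c + a) (c + b) (c + s)
Between-+ˡ c (inj₁ (a≤s , s≤b)) = inj₁ (+-monoʳ-≤ c a≤s , +-monoʳ-≤ c s≤b)
Between-+ˡ c (inj₂ (b≤s , s≤a)) = inj₂ (+-monoʳ-≤ c b≤s , +-monoʳ-≤ c s≤a)

Between-neg : ∀ {a b s} → Between a b s → Between (- a) (- b) (- s)
Between-neg (inj₁ (a≤s , s≤b)) = inj₂ (neg-mono-≤ s≤b , neg-mono-≤ a≤s)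
Between-neg (inj₂ (b≤s , s≤a)) = inj₁ (neg-mono-≤ s≤a , neg-mono-≤ b≤s)

i<j⇒∃j≡i+suc : ∀ {i j} → i ℤ.< j → ∃ λ n → j ≡ i + + suc n
i<j⇒∃j≡i+suc {i} {j} i<j = ℤ.∣ j - (1ℤ + i) ∣ , (begin
  j                              ≡⟨ rearrange i j ⟩
  i + (1ℤ + (j - (1ℤ + i)))      ≡⟨ cong (λ x → i + (1ℤ + x)) (sym (0≤i⇒+∣i∣≡i 0≤gap)) ⟩
  i + (1ℤ + + ℤ.∣ j - (1ℤ + i) ∣) ∎)
  where
  open ≡-Reasoning
  rearrange : ∀ i j → j ≡ i + (1ℤ + (j - (1ℤ + i)))
  rearrange = solve-∀
  0≤gap : 0ℤ ℤ.≤ j - (1ℤ + i)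
  0≤gap = i≤j⇒0≤j-i (i<j⇒suc[i]≤j i<j)

module _ {d : ℕ} (P : Cubes d) where

  Visible : Pt d → Pt d → ℤ → Set
  Visible c u t = ∀ s → Between 0ℤ t s → line c u s ∈ P

  Sees : Pt d → Pt d → Pt d → Set
  Sees c u q = ∃ λ t → q ≡ line c u t × Visible c u t

  visible-+ : ∀ {c u} k → (∀ n → n ℕ.≤ k → line c u (+ n) ∈ P) → Visible c u (+ k)
  visible-+ k onSegment s (inj₁ (+≤+ {n = n} _ , +≤+ n≤k)) = onSegment n n≤k
  visible-+ k onSegment s (inj₂ (k≤s , s≤0)) =
    subst (λ x → line _ _ x ∈ P) (≤-antisym (≤-trans (+≤+ z≤n) k≤s) s≤0) (onSegment 0 z≤n)

  visible-neg : ∀ {c u t} → Visible c (neg u) t → Visible c u (- t)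
  visible-neg {c} {u} {t} vis s between = subst (_∈ P) seen (vis (- s) between′)
    where
    between′ : Between 0ℤ t (- s)
    between′ = subst (λ x → Between 0ℤ x (- s)) (neg-involutive t) (Between-neg between)
    seen : line c (neg u) (- s) ≡ line c u s
    seen = trans (line-neg c u (- s)) (cong (line c u) (neg-involutive s))

  visible-reverse : ∀ {c u t} → Visible c u t → Visible (line c u t) u (- t)
  visible-reverse {c} {u} {t} vis s between =
    subst (_∈ P) (sym (line-line c u t s)) (vis (t + s) (Between-sym between′))
    where
    between′ : Between t 0ℤ (t + s)
    between′ = subst₂ (λ a b → Between a b (t + s)) (+-identityʳ t) (+-inverseʳ t)
                      (Between-+ˡ t between)

  visible-cover : ∀ {c u ta tb s} → Visible c u ta → Visible c u tb →
    ta ℤ.≤ s → s ℤ.≤ tb → line c u s ∈ P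
  visible-cover {s = s} visa visb ta≤s s≤tb with ≤-total s 0ℤ
  ... | inj₁ s≤0 = visa s (inj₂ (ta≤s , s≤0))
  ... | inj₂ 0≤s = visb s (inj₁ (0≤s , s≤tb))

  sees-neg : ∀ {c u q} → Sees c (neg u) q → Sees c u q
  sees-neg {c} {u} (t , q≡ , vis) = - t , trans q≡ (line-neg c u t) , visible-neg vis

  sees-reverse : ∀ {p u c} → Sees p u c → Sees c u p
  sees-reverse {p} {u} (t , refl , vis) = - t , back , visible-reverse vis
    where
    open ≡-Reasoning
    back : p ≡ line (line p u t) u (- t)
    back = sym (begin
      line (line p u t) u (- t) ≡⟨ line-line p u t (- t) ⟩
      line p u (t + - t)        ≡⟨ cong (line p u) (+-inverseʳ t) ⟩
      line p u 0ℤ               ≡⟨ line-0 p u ⟩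
      p                         ∎)

  guardsAlong⇒sees : ∀ {c u q} → c ∈ P → GuardsAlong P u c q → Sees c u q
  guardsAlong⇒sees {c} {u} c∈P (k , _ , q≡ , guarded) =
    + k , trans q≡ (⊕-·-line c u k) , visible-+ k onSegment
    where
    onSegment : ∀ n → n ℕ.≤ k → line c u (+ n) ∈ P
    onSegment zero    _   = subst (_∈ P) (sym (line-0 c u)) c∈P
    onSegment (suc n) n<k = subst (_∈ P) (⊕-·-line c u (suc n)) (guarded (suc n) (s≤s z≤n) n<k)

  chessAdj⇒sees : ∀ {m} (D : Vec (Pt d) m) {c q} → ChessAdj P D c q →
    ∃ λ j → Sees c (lookup D j) q
  chessAdj⇒sees D (c∈P , _ , inj₁ (j , inj₁ g)) = j , guardsAlong⇒sees c∈P g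
  chessAdj⇒sees D (c∈P , _ , inj₁ (j , inj₂ g)) = j , sees-neg (guardsAlong⇒sees c∈P g)
  chessAdj⇒sees D (_ , q∈P , inj₂ (j , inj₁ g)) = j , sees-reverse (guardsAlong⇒sees q∈P g)
  chessAdj⇒sees D (_ , q∈P , inj₂ (j , inj₂ g)) =
    j , sees-reverse (sees-neg (guardsAlong⇒sees q∈P g))

  segment⇒guardsAlong : ∀ {c u ta tb} → ta ℤ.< tb →
    (∀ s → ta ℤ.≤ s → s ℤ.≤ tb → line c u s ∈ P) →
    GuardsAlong P u (line c u ta) (line c u tb)
  segment⇒guardsAlong {c} {u} {ta} {tb} ta<tb onSegment
    with n , tb≡ ← i<j⇒∃j≡i+suc ta<tb = suc n , s≤s z≤n , end≡ , guarded
    where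
    step≡ : ∀ j → line c u ta ⊕ (j · u) ≡ line c u (ta + + j)
    step≡ j = trans (⊕-·-line (line c u ta) u j) (line-line c u ta (+ j))
    end≡ : line c u tb ≡ line c u ta ⊕ (suc n · u)
    end≡ = trans (cong (line c u) tb≡) (sym (step≡ (suc n)))
    guarded : ∀ j → 1 ℕ.≤ j → j ℕ.≤ suc n → (line c u ta ⊕ (j · u)) ∈ P
    guarded j _ j≤k = subst (_∈ P) (sym (step≡ j))
      (onSegment (ta + + j) (i≤i+j ta (+ j))
                 (subst (ta + + j ℤ.≤_) (sym tb≡) (+-monoʳ-≤ ta (+≤+ j≤k))))

  sees-collinear⇒guards : ∀ {c u q q′} → Sees c u q → Sees c u q′ →
    q ≡ q′ ⊎ GuardsAlong P u q q′ ⊎ GuardsAlong P u q′ q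
  sees-collinear⇒guards (ta , refl , visa) (tb , refl , visb) with <-cmp ta tb
  ... | tri< ta<tb _ _ = inj₂ (inj₁ (segment⇒guardsAlong ta<tb (λ _ → visible-cover visa visb)))
  ... | tri≈ _ refl _ = inj₁ refl
  ... | tri> _ _ tb<ta = inj₂ (inj₂ (segment⇒guardsAlong tb<ta (λ _ → visible-cover visb visa)))

  pigeonhole-direction : ∀ {m n} (D : Vec (Pt d) m) {c} (f : Fin n → Pt d) → m ℕ.< n →
    (∀ i → ChessAdj P D c (f i)) →
    ∃ λ a → ∃ λ b → a Fin.< b × ∃ λ j → Sees c (lookup D j) (f a) × Sees c (lookup D j) (f b)
  pigeonhole-direction D {c} f m<n c~f
    with a , b , a<b , same ← pigeonhole m<n (λ i → proj₁ (chessAdj⇒sees D (c~f i)))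
    with ja , sa ← chessAdj⇒sees D (c~f a)
    with jb , sb ← chessAdj⇒sees D (c~f b)
    = a , b , a<b , ja , sa , subst (λ j → Sees c (lookup D j) (f b)) (sym same) sb

proposition5p3 : (d m : ℕ) (P : Cubes d) (D : Vec (Pt d) m) →
    IsPolycube P → ValidDirections D →
    ClawFree P (ChessAdj P D) (suc m)
proposition5p3 d m P D _ _ (c , f , _ , f∈P , f-injective , _ , c~f , f≁f)
  with a , b , a<b , j , sa , sb ← pigeonhole-direction P D f (ℕ.n<1+n m) c~f
  with sees-collinear⇒guards P sa sb
... | inj₁ fa≡fb = <⇒≢ a<b (f-injective a b fa≡fb)
... | inj₂ (inj₁ g) = f≁f a b (<⇒≢ a<b) (f∈P a , f∈P b , inj₁ (j , inj₁ g))
... | inj₂ (inj₂ g) = f≁f a b (<⇒≢ a<b) (f∈P a , f∈P b , inj₂ (j , inj₁ g))
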